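{- Let $G$ be any graph on vertex set $[n]$, let $p\in(0,1)$, $0<k<n$, and let $D_V$ be a positive integer. For $S\subseteq[n]$ define \[\widetilde{\mathbb{E}}[x_S](G)=\sum_{\alpha\in T(S)}\left(\frac{k}{n}\right)^{|V(\alpha)\cup S|}\left(-\sqrt{\frac{p}{1-p}}\right)^{|E(\alpha)|}\chi_\alpha(G).\] Then for every $S\subseteq[n]$ that is not an independent set in $G$, $\widetilde{\mathbb{E}}[x_S](G)=0$.
   Context: For a pair $e=\{u,v\}$, $\chi_G(e)=\sqrt{(1-p)/p}$ if $e$ is an edge of $G$ and $-\sqrt{p/(1-p)}$ otherwise; for a set of pairs $\alpha$, $\chi_\alpha(G)=\prod_{e\in\alpha}\chi_G(e)$ (empty product $=1$). For $S\subseteq[n]$, $T(S)$ is the set of graphs $\alpha$ (edge sets $E(\alpha)\subseteq\binom{[n]}{2}$ with vertex set $V(\alpha)$ the set of endpoints) such that: (size) $|V(\alpha)\cup S|\le D_V$; (connectivity) every vertex of $V(\alpha)$ is reachable from $S$ using edges of $\alpha$; (non-dangling) every vertex of $V(\alpha)\setminus S$ has degree at least $2$ in $\alpha$. (In the paper, $p=d/n$ and $D_V=c_{\text{trunc}}\cdot d_{sos}\log n$.) -}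

module Defs where

open import Level using (Level)
open import Data.Bool using (Bool; true; false; if_then_else_; _∧_)
open import Data.Nat using (ℕ; zero; suc; _≤_; _<ᵇ_)
open import Data.Fin using (Fin; toℕ)
open import Data.Fin.Subset using (Subset; _∈_; _∉_; _∪_; ∣_∣)
open import Data.Vec using (Vec; lookup; tabulate)
open import Data.List using (List; []; _∷_; allFin; filter; length; cartesianProduct; foldr)
open import Data.Bool.ListAction using (any)
open import Data.Product using (_×_; _,_; proj₁; proj₂)
open import Relation.Binary.PropositionalEquality using (_≡_)
open import Relation.Nullary.Decidable using (does)
open import Data.Bool.Properties using (T?)
open import Data.Bool using (T)
open import Algebra.Bundles using (CommutativeRing)

-- A (candidate) edge set / graph on vertex set [n] = Fin n, as a Boolean
-- adjacency matrix.
Adj : ℕ → Set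
Adj n = Vec (Vec Bool n) n

edge : ∀ {n} → Adj n → Fin n → Fin n → Bool
edge A u v = lookup (lookup A u) v

IsGraph : ∀ {n} → Adj n → Set
IsGraph {n} A = (∀ (u v : Fin n) → edge A u v ≡ edge A v u) × (∀ (u : Fin n) → edge A u u ≡ false)

-- E(α): the unordered pairs {u,v} (listed once, as (u,v) with u < v) that are edges
E : ∀ {n} → Adj n → List (Fin n × Fin n)
E {n} A = filter (λ uv → T? ((toℕ (proj₁ uv) <ᵇ toℕ (proj₂ uv)) ∧ edge A (proj₁ uv) (proj₂ uv)))
                 (cartesianProduct (allFin n) (allFin n))

V : ∀ {n} → Adj n → Subset n
V {n} A = tabulate (λ u → any (edge A u) (allFin n))

deg : ∀ {n} → Adj n → Fin n → ℕ
deg {n} A u = length (filter (λ v → T? (edge A u v)) (allFin n))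

data Reach {n} (A : Adj n) (S : Subset n) : Fin n → Set where
  base : ∀ {u} → u ∈ S → Reach A S u
  step : ∀ {u v} → Reach A S u → edge A u v ≡ true → Reach A S v

InT : ∀ {n} → ℕ → Subset n → Adj n → Set
InT {n} DV S α =
  IsGraph α
  × (∣ V α ∪ S ∣ ≤ DV)
  × (∀ (u : Fin n) → u ∈ V α → Reach α S u)
  × (∀ (u : Fin n) → u ∈ V α → u ∉ S → 2 ≤ deg α u)

NotIndependent : ∀ {n} → Adj n → Subset n → Set
NotIndependent {n} G S = Data.Product.Σ (Fin n) λ u → Data.Product.Σ (Fin n) λ v →
  u ∈ S × v ∈ S × edge G u v ≡ true

module RingDefs {c ℓ : Level} (R : CommutativeRing c ℓ) where
  open CommutativeRing R

  pow : Carrier → ℕ → Carrier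
  pow x zero = 1#
  pow x (suc m) = x * pow x m

  fromℕ : ℕ → Carrier
  fromℕ zero = 0#
  fromℕ (suc m) = 1# + fromℕ m

  sumR : List Carrier → Carrier
  sumR = foldr _+_ 0#

  prodR : List Carrier → Carrier
  prodR = foldr _*_ 1#

  -- χ_G(e) with a = sqrt((1-p)/p), b = sqrt(p/(1-p))
  chiEdge : ∀ {n} → (a b : Carrier) → Adj n → Fin n × Fin n → Carrier
  chiEdge a b G (u , v) = if edge G u v then a else - b

  chi : ∀ {n} → (a b : Carrier) → Adj n → Adj n → Carrier
  chi a b G α = prodR (Data.List.map (chiEdge a b G) (E α))

  term : ∀ {n} → (κ a b : Carrier) → Adj n → Subset n → Adj n → Carrier
  term κ a b G S α = pow κ ∣ V α ∪ S ∣ * (pow (- b) (length (E α)) * chi a b G α)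

  -- Ẽ[x_S](G) = Σ_{α ∈ T(S)} term, where L is an enumeration of T(S)
  pE : ∀ {n} → (κ a b : Carrier) → Adj n → Subset n → List (Adj n) → Carrier
  pE κ a b G S L = sumR (Data.List.map (term κ a b G S) L)

module Submission where

-- If u, v ∈ S are adjacent in G, toggling the pair uv is a fixed-point-free involution
-- of T(S): as both endpoints lie in S, it changes neither V(α) ∪ S nor reachability
-- from S nor any degree outside S. It changes E(α) by exactly the pair uv, so it
-- multiplies the summand by (-√(p/(1-p))) χ_G(uv) = -√(p/(1-p)) √((1-p)/p) = -1,
-- and the summands cancel in pairs.

open import Level using (Level)
open import Algebra.Bundles using (CommutativeMonoid; CommutativeRing)
open import Algebra.Definitions using (Involutive)
open import Data.Bool using (Bool; true; false; not; _xor_; _∧_; if_then_else_)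
open import Data.Bool.ListAction using (any; or)
open import Data.Bool.Properties using (xor-comm; true-xor; xor-identityʳ; not-involutive; not-¬)
open import Data.Fin using (Fin; toℕ; _≟_)
open import Data.Fin.Properties using (toℕ-injective)
open import Data.Fin.Subset using (Subset; _∈_; _∉_; _∪_; _⊆_; ∣_∣)
open import Data.Fin.Subset.Properties using (_∈?_; ⊆-antisym; x∈p∪q⁻; x∈p∪q⁺)
open import Data.List using (List; []; _∷_; _++_; map; filter; foldr; length; allFin; cartesianProduct)
open import Data.List.Properties using (map-cong)
open import Data.List.Membership.Propositional using () renaming (_∈_ to _∈ₗ_)
open import Data.List.Membership.Propositional.Properties using (∈-∃++; ∈-cartesianProduct⁺; ∈-allFin)
open import Data.List.Relation.Unary.All as All using (All; []; _∷_)
open import Data.List.Relation.Unary.Any using (here; there)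
open import Data.List.Relation.Unary.Unique.Propositional as Unique using (Unique; _∷_)
open import Data.List.Relation.Unary.Unique.Propositional.Properties using (cartesianProduct⁺; allFin⁺)
open import Data.List.Relation.Binary.Permutation.Propositional
  using (_↭_; ↭-refl; ↭-reflexive; ↭-prep; ↭-swap; ↭-trans; ↭-sym; ↭⇒↭ₛ; ↭⇒↭ₛ′)
open import Data.List.Relation.Binary.Permutation.Propositional.Properties
  using (shift; ∈-resp-↭; ↭-length; map⁺)
import Data.List.Relation.Binary.Permutation.Setoid.Properties as ↭ₛ
open import Data.Nat using (ℕ; suc; _<_; _≤_; _<ᵇ_)
open import Data.Nat.Properties using (n<1+n; m<n⇒m<1+n; <⇒<ᵇ; <ᵇ⇒<; <-asym; <-irrefl; <-cmp)
open import Data.Nat.Induction using (<-wellFounded)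
open import Data.Product using (_×_; _,_; proj₁; proj₂; ∃₂)
open import Data.Sum using (_⊎_; inj₁; inj₂)
open import Data.Vec using (Vec; lookup; tabulate)
open import Data.Vec.Properties using (lookup∘tabulate; tabulate∘lookup; tabulate-cong; []=⇒lookup; lookup⇒[]=)
open import Function using (_∘_)
open import Induction.WellFounded using (Acc; acc)
open import Relation.Binary using (tri<; tri≈; tri>)
open import Relation.Binary.PropositionalEquality
  using (_≡_; _≢_; _≗_; refl; sym; trans; cong; cong₂; subst; module ≡-Reasoning)
  renaming (setoid to ≡-setoid)
open import Relation.Nullary using (Dec; yes; no; ¬_; does)
open import Relation.Nullary.Decidable using (T?; dec-true; dec-false; _×-dec_; _⊎-dec_)
open import Relation.Nullary.Negation using (contradiction)

open import Defs

private
  variable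
    a : Level
    A : Set a

filter-agree : (p q : A → Bool) {xs : List A} → All (λ y → p y ≡ q y) xs →
  filter (T? ∘ p) xs ≡ filter (T? ∘ q) xs
filter-agree p q [] = refl
filter-agree p q {x ∷ _} (px≡qx ∷ rest) with p x | q x | px≡qx
... | true  | .true  | refl = cong (x ∷_) (filter-agree p q rest)
... | false | .false | refl = filter-agree p q rest

filter-↭-∷ : (p q : A → Bool) (z : A) → p z ≡ false → q z ≡ true →
  (∀ y → y ≢ z → p y ≡ q y) → {xs : List A} → Unique xs → z ∈ₗ xs →
  filter (T? ∘ q) xs ↭ z ∷ filter (T? ∘ p) xs
filter-↭-∷ p q z pz qz agree (z∉xs ∷ _) (here refl) with p z | q z | pz | qz
... | false | true | refl | refl =
  ↭-prep z (↭-reflexive (filter-agree q p (All.map (λ z≢y → sym (agree _ (z≢y ∘ sym))) z∉xs)))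
filter-↭-∷ p q z pz qz agree {x ∷ _} (x∉xs ∷ u) (there z∈xs)
  with p x | q x | agree x (All.lookup x∉xs z∈xs)
... | true  | .true  | refl =
  ↭-trans (↭-prep x (filter-↭-∷ p q z pz qz agree u z∈xs)) (↭-swap x z ↭-refl)
... | false | .false | refl = filter-↭-∷ p q z pz qz agree u z∈xs

Unique-resp-↭ : {xs ys : List A} → xs ↭ ys → Unique xs → Unique ys
Unique-resp-↭ {A = A} = ↭ₛ.Unique-resp-↭ (≡-setoid A) ∘ ↭⇒↭ₛ

module InvolutionSum {c ℓ : Level} (M : CommutativeMonoid c ℓ) where
  open CommutativeMonoid M
    using (Carrier; _≈_; _∙_; ε; setoid; isEquivalence; isCommutativeMonoid; assoc; ∙-cong; identityˡ)
    renaming (refl to ≈-refl)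
  open import Relation.Binary.Reasoning.Setoid setoid

  fold : List Carrier → Carrier
  fold = foldr _∙_ ε

  fold-map-↭ : (f : A → Carrier) {xs ys : List A} → xs ↭ ys → fold (map f xs) ≈ fold (map f ys)
  fold-map-↭ f = ↭ₛ.foldr-commMonoid setoid isCommutativeMonoid ∘ ↭⇒↭ₛ′ isEquivalence ∘ map⁺ f

  fold-map≈ε-by-involution : (t : A → A) (f : A → Carrier) →
    Involutive _≡_ t → (∀ x → t x ≢ x) → (∀ x → f x ∙ f (t x) ≈ ε) →
    {xs : List A} → Unique xs → (∀ {x} → x ∈ₗ xs → t x ∈ₗ xs) → fold (map f xs) ≈ ε
  fold-map≈ε-by-involution {A = A} t f t-inv t-nofix cancels = go _ (<-wellFounded _)
    where
    t-injective : ∀ {y z} → t y ≡ t z → y ≡ z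
    t-injective {y} {z} ty≡tz = trans (sym (t-inv y)) (trans (cong t ty≡tz) (t-inv z))
    go : (xs : List A) → Acc _<_ (length xs) → Unique xs → (∀ {x} → x ∈ₗ xs → t x ∈ₗ xs) →
         fold (map f xs) ≈ ε
    go [] _ _ _ = ≈-refl
    go (x ∷ xs) (acc smaller) unique closed with closed (here refl)
    ... | here tx≡x = contradiction tx≡x (t-nofix x)
    ... | there tx∈xs with ys , zs , refl ← ∈-∃++ tx∈xs = begin
      fold (map f (x ∷ ys ++ t x ∷ zs))  ≈⟨ fold-map-↭ f pairs-first ⟩
      f x ∙ (f (t x) ∙ fold (map f rest)) ≈⟨ assoc _ _ _ ⟨
      (f x ∙ f (t x)) ∙ fold (map f rest) ≈⟨ ∙-cong (cancels x) rest≈ε ⟩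
      ε ∙ ε                              ≈⟨ identityˡ ε ⟩
      ε                                  ∎
      where
      rest : List A
      rest = ys ++ zs
      pairs-first : x ∷ ys ++ t x ∷ zs ↭ x ∷ t x ∷ rest
      pairs-first = ↭-prep x (shift (t x) ys zs)
      front-unique : Unique (x ∷ t x ∷ rest)
      front-unique = Unique-resp-↭ pairs-first unique
      x∉rest : All (x ≢_) rest
      x∉rest = All.tail (Unique.head front-unique)
      tx∉rest : All (t x ≢_) rest
      tx∉rest = Unique.head (Unique.tail front-unique)
      rest-closed : ∀ {y} → y ∈ₗ rest → t y ∈ₗ rest
      rest-closed {y} y∈rest
        with ∈-resp-↭ pairs-first (closed (∈-resp-↭ (↭-sym pairs-first) (there (there y∈rest))))
      ... | here ty≡x = contradiction (t-injective (trans ty≡x (sym (t-inv x)))) (All.lookup tx∉rest y∈rest ∘ sym)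
      ... | there (here ty≡tx) = contradiction (t-injective ty≡tx) (All.lookup x∉rest y∈rest ∘ sym)
      ... | there (there ty∈rest) = ty∈rest
      rest-shorter : length rest < length (x ∷ ys ++ t x ∷ zs)
      rest-shorter = subst (length rest <_) (sym (↭-length pairs-first)) (m<n⇒m<1+n (n<1+n _))
      rest≈ε : fold (map f rest) ≈ ε
      rest≈ε = go rest (smaller rest-shorter) (Unique.tail (Unique.tail front-unique)) rest-closed

vec-ext : ∀ {a} {A : Set a} {m} {xs ys : Vec A m} → (∀ i → lookup xs i ≡ lookup ys i) → xs ≡ ys
vec-ext {xs = xs} {ys} eq = trans (sym (tabulate∘lookup xs)) (trans (tabulate-cong eq) (tabulate∘lookup ys))

adj-ext : ∀ {n} {A B : Adj n} → (∀ x y → edge A x y ≡ edge B x y) → A ≡ B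
adj-ext eq = vec-ext (λ x → vec-ext (eq x))

module _ {n : ℕ} (u v : Fin n) where

  IsPair : Fin n → Fin n → Set
  IsPair x y = (x ≡ u × y ≡ v) ⊎ (x ≡ v × y ≡ u)

  isPair? : ∀ x y → Dec (IsPair x y)
  isPair? x y = (x ≟ u ×-dec y ≟ v) ⊎-dec (x ≟ v ×-dec y ≟ u)

  IsPair-sym : ∀ {x y} → IsPair x y → IsPair y x
  IsPair-sym (inj₁ (x≡u , y≡v)) = inj₂ (y≡v , x≡u)
  IsPair-sym (inj₂ (x≡v , y≡u)) = inj₁ (y≡u , x≡v)

  IsPair-endpoint : ∀ {x y} → IsPair x y → y ≡ u ⊎ y ≡ v
  IsPair-endpoint (inj₁ (_ , y≡v)) = inj₂ y≡v
  IsPair-endpoint (inj₂ (_ , y≡u)) = inj₁ y≡u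

  toggle : Adj n → Adj n
  toggle A = tabulate λ x → tabulate λ y → edge A x y xor does (isPair? x y)

  edge-toggle : ∀ A x y → edge (toggle A) x y ≡ edge A x y xor does (isPair? x y)
  edge-toggle A x y = trans (cong (λ row → lookup row y) (lookup∘tabulate _ x)) (lookup∘tabulate _ y)

  edge-toggle-pair : ∀ A {x y} → IsPair x y → edge (toggle A) x y ≡ not (edge A x y)
  edge-toggle-pair A {x} {y} p rewrite edge-toggle A x y | dec-true (isPair? x y) p =
    trans (xor-comm _ true) (true-xor _)

  edge-toggle-other : ∀ A {x y} → ¬ IsPair x y → edge (toggle A) x y ≡ edge A x y
  edge-toggle-other A {x} {y} ¬p rewrite edge-toggle A x y | dec-false (isPair? x y) ¬p =
    xor-identityʳ _

  toggle-involutive : ∀ A → toggle (toggle A) ≡ A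
  toggle-involutive A = adj-ext λ x y → entry (isPair? x y)
    where
    entry : ∀ {x y} → Dec (IsPair x y) → edge (toggle (toggle A)) x y ≡ edge A x y
    entry (yes p) = trans (edge-toggle-pair (toggle A) p)
                          (trans (cong not (edge-toggle-pair A p)) (not-involutive _))
    entry (no ¬p) = trans (edge-toggle-other (toggle A) ¬p) (edge-toggle-other A ¬p)

  toggle-≢ : ∀ A → toggle A ≢ A
  toggle-≢ A eq = not-¬ refl (trans (sym (cong (λ B → edge B u v) eq))
                                    (edge-toggle-pair A (inj₁ (refl , refl))))

  IsGraph-toggle : u ≢ v → ∀ A → IsGraph A → IsGraph (toggle A)
  IsGraph-toggle u≢v A (symmetric , loopless) = symmetric′ , loopless′
    where
    symmetric′ : ∀ x y → edge (toggle A) x y ≡ edge (toggle A) y x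
    symmetric′ x y with isPair? x y
    ... | yes p = trans (edge-toggle-pair A p)
                   (trans (cong not (symmetric x y)) (sym (edge-toggle-pair A (IsPair-sym p))))
    ... | no ¬p = trans (edge-toggle-other A ¬p)
                   (trans (symmetric x y) (sym (edge-toggle-other A (¬p ∘ IsPair-sym))))
    not-loop : ∀ {x} → ¬ IsPair x x
    not-loop (inj₁ (refl , refl)) = u≢v refl
    not-loop (inj₂ (refl , refl)) = u≢v refl
    loopless′ : ∀ x → edge (toggle A) x x ≡ false
    loopless′ x = trans (edge-toggle-other A not-loop) (loopless x)

  module _ (S : Subset n) (u∈S : u ∈ S) (v∈S : v ∈ S) where

    not-endpoint : ∀ {w} → w ∉ S → ¬ (w ≡ u ⊎ w ≡ v)
    not-endpoint w∉S (inj₁ refl) = w∉S u∈S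
    not-endpoint w∉S (inj₂ refl) = w∉S v∈S

    edge-toggle-∉S-col : ∀ A {x y} → y ∉ S → edge (toggle A) x y ≡ edge A x y
    edge-toggle-∉S-col A y∉S = edge-toggle-other A (not-endpoint y∉S ∘ IsPair-endpoint)

    edge-toggle-∉S-row : ∀ A {x} → x ∉ S → edge (toggle A) x ≗ edge A x
    edge-toggle-∉S-row A x∉S y = edge-toggle-other A (not-endpoint x∉S ∘ IsPair-endpoint ∘ IsPair-sym)

    ∈-V-toggle : ∀ A {w} → w ∉ S → w ∈ V (toggle A) → w ∈ V A
    ∈-V-toggle A {w} w∉S w∈V = lookup⇒[]= w (V A) (begin
      lookup (V A) w                              ≡⟨ lookup∘tabulate _ w ⟩
      any (edge A w) (allFin n)
        ≡⟨ cong or (map-cong (sym ∘ edge-toggle-∉S-row A w∉S) (allFin n)) ⟩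
      any (edge (toggle A) w) (allFin n)          ≡⟨ lookup∘tabulate _ w ⟨
      lookup (V (toggle A)) w                     ≡⟨ []=⇒lookup w∈V ⟩
      true                                        ∎)
      where open ≡-Reasoning

    V∪S-toggle-⊆ : ∀ A → V (toggle A) ∪ S ⊆ V A ∪ S
    V∪S-toggle-⊆ A {w} w∈ with x∈p∪q⁻ (V (toggle A)) S w∈ | w ∈? S
    ... | inj₂ w∈S | _       = x∈p∪q⁺ (inj₂ w∈S)
    ... | inj₁ _   | yes w∈S = x∈p∪q⁺ (inj₂ w∈S)
    ... | inj₁ w∈V | no w∉S  = x∈p∪q⁺ (inj₁ (∈-V-toggle A w∉S w∈V))

    V∪S-toggle : ∀ A → V (toggle A) ∪ S ≡ V A ∪ S
    V∪S-toggle A = ⊆-antisym (V∪S-toggle-⊆ A)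
      (subst (λ B → V B ∪ S ⊆ V (toggle A) ∪ S) (toggle-involutive A) (V∪S-toggle-⊆ (toggle A)))

    deg-toggle : ∀ A {w} → w ∉ S → deg (toggle A) w ≡ deg A w
    deg-toggle A w∉S = cong length
      (filter-agree (edge (toggle A) _) (edge A _) {allFin n}
        (All.tabulate λ {y} _ → edge-toggle-∉S-row A w∉S y))

    Reach-toggle : ∀ {A w} → Reach A S w → Reach (toggle A) S w
    Reach-toggle (base w∈S) = base w∈S
    Reach-toggle {A} (step {v = y} r e) with y ∈? S
    ... | yes y∈S = base y∈S
    ... | no y∉S  = step (Reach-toggle r) (trans (edge-toggle-∉S-col A y∉S) e)

    InT-toggle : u ≢ v → ∀ {DV A} → InT DV S A → InT DV S (toggle A)
    InT-toggle u≢v {DV} {A} (graph , size , reach , nondangling) =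
      IsGraph-toggle u≢v A graph ,
      subst (λ B → ∣ B ∣ ≤ DV) (sym (V∪S-toggle A)) size ,
      reach′ ,
      nondangling′
      where
      reach′ : ∀ w → w ∈ V (toggle A) → Reach (toggle A) S w
      reach′ w w∈V with w ∈? S
      ... | yes w∈S = base w∈S
      ... | no w∉S  = Reach-toggle (reach w (∈-V-toggle A w∉S w∈V))
      nondangling′ : ∀ w → w ∈ V (toggle A) → w ∉ S → 2 ≤ deg (toggle A) w
      nondangling′ w w∈V w∉S =
        subst (2 ≤_) (sym (deg-toggle A w∉S)) (nondangling w (∈-V-toggle A w∉S w∈V) w∉S)

-- E A is definitionally filter (T? ∘ isEdge A) over all ordered pairs.
isEdge : ∀ {n} → Adj n → Fin n × Fin n → Bool
isEdge A e = (toℕ (proj₁ e) <ᵇ toℕ (proj₂ e)) ∧ edge A (proj₁ e) (proj₂ e)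

module _ {n : ℕ} {u v : Fin n} (u<v : toℕ u < toℕ v) where

  E-toggle : ∀ A → edge A u v ≡ false → E (toggle u v A) ↭ (u , v) ∷ E A
  E-toggle A uv∉A =
    filter-↭-∷ (isEdge A) (isEdge (toggle u v A)) (u , v) uv∉A′ uv∈toggle agree
      (cartesianProduct⁺ (allFin⁺ n) (allFin⁺ n)) (∈-cartesianProduct⁺ (∈-allFin u) (∈-allFin v))
    where
    u<ᵇv : (toℕ u <ᵇ toℕ v) ≡ true
    u<ᵇv = dec-true (T? _) (<⇒<ᵇ u<v)
    v≮ᵇu : (toℕ v <ᵇ toℕ u) ≡ false
    v≮ᵇu = dec-false (T? _) (<-asym u<v ∘ <ᵇ⇒< _ _)
    uv∉A′ : isEdge A (u , v) ≡ false
    uv∉A′ rewrite u<ᵇv | uv∉A = refl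
    uv∈toggle : isEdge (toggle u v A) (u , v) ≡ true
    uv∈toggle rewrite u<ᵇv | edge-toggle-pair u v A (inj₁ (refl , refl)) | uv∉A = refl
    agree : ∀ e → e ≢ (u , v) → isEdge A e ≡ isEdge (toggle u v A) e
    agree (x , y) e≢uv with isPair? u v x y
    ... | yes (inj₁ (refl , refl)) = contradiction refl e≢uv
    ... | yes (inj₂ (refl , refl)) rewrite v≮ᵇu = refl
    ... | no ¬p = cong ((toℕ x <ᵇ toℕ y) ∧_) (sym (edge-toggle-other u v A ¬p))

-- E lists an edge {u , v} only as (u , v) with u < v, hence the orientation.
ordered-edge : ∀ {n} (G : Adj n) {S : Subset n} → IsGraph G → NotIndependent G S →
  ∃₂ λ u v → u ∈ S × v ∈ S × toℕ u < toℕ v × edge G u v ≡ true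
ordered-edge G (symmetric , loopless) (x , y , x∈S , y∈S , xy∈G) with <-cmp (toℕ x) (toℕ y)
... | tri< x<y _ _ = x , y , x∈S , y∈S , x<y , xy∈G
... | tri> _ _ y<x = y , x , y∈S , x∈S , y<x , trans (symmetric y x) xy∈G
... | tri≈ _ x≡y _ with toℕ-injective x≡y
...   | refl = contradiction (trans (sym xy∈G) (loopless x)) λ ()

module _ {c ℓ : Level} (R : CommutativeRing c ℓ) where
  open CommutativeRing R renaming (refl to ≈-refl; sym to ≈-sym; trans to ≈-trans)
  open RingDefs R
  open import Algebra.Properties.Ring ring using (-1*x≈-x; -‿distribˡ-*; -‿distribʳ-*)
  open import Algebra.Properties.CommutativeSemigroup *-commutativeSemigroup using (interchange)
  open import Relation.Binary.Reasoning.Setoid setoid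
  open InvolutionSum *-commutativeMonoid using (fold-map-↭)
  open InvolutionSum +-commutativeMonoid using (fold-map≈ε-by-involution)

  pow-neg-suc : ∀ {a b} → a * b ≈ 1# → ∀ m x → pow (- b) (suc m) * (a * x) ≈ - (pow (- b) m * x)
  pow-neg-suc {a} {b} a*b≈1 m x = begin
    (- b * pow (- b) m) * (a * x) ≈⟨ interchange (- b) (pow (- b) m) a x ⟩
    (- b * a) * (pow (- b) m * x) ≈⟨ *-congʳ (-‿distribˡ-* b a) ⟨
    - (b * a) * (pow (- b) m * x) ≈⟨ *-congʳ (-‿cong (≈-trans (*-comm b a) a*b≈1)) ⟩
    - 1# * (pow (- b) m * x)      ≈⟨ -1*x≈-x _ ⟩
    - (pow (- b) m * x)           ∎

  module _ (κ a b : Carrier) (a*b≈1 : a * b ≈ 1#) {n : ℕ} (G : Adj n) (S : Subset n)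
           {u v : Fin n} (u<v : toℕ u < toℕ v) (u∈S : u ∈ S) (v∈S : v ∈ S)
           (uv∈G : edge G u v ≡ true) where

    chi-toggle : ∀ A → edge A u v ≡ false → chi a b G (toggle u v A) ≈ a * chi a b G A
    chi-toggle A uv∉A = ≈-trans (fold-map-↭ (chiEdge a b G) (E-toggle u<v A uv∉A))
                              (*-congʳ (reflexive (cong (if_then a else - b) uv∈G)))

    term-toggle : ∀ A → edge A u v ≡ false → term κ a b G S (toggle u v A) ≈ - term κ a b G S A
    term-toggle A uv∉A = begin
      pow κ ∣ V (toggle u v A) ∪ S ∣ * (pow (- b) (length (E (toggle u v A))) * chi a b G (toggle u v A))
        ≡⟨ cong₂ (λ V∪S m → pow κ ∣ V∪S ∣ * (pow (- b) m * chi a b G (toggle u v A)))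
                 (V∪S-toggle u v S u∈S v∈S A) (↭-length (E-toggle u<v A uv∉A)) ⟩
      P * (pow (- b) (suc m) * chi a b G (toggle u v A)) ≈⟨ *-congˡ (*-congˡ (chi-toggle A uv∉A)) ⟩
      P * (pow (- b) (suc m) * (a * chi a b G A))        ≈⟨ *-congˡ (pow-neg-suc a*b≈1 m _) ⟩
      P * - (pow (- b) m * chi a b G A)                   ≈⟨ -‿distribʳ-* P _ ⟨
      - term κ a b G S A                                  ∎
      where
      P : Carrier
      P = pow κ ∣ V A ∪ S ∣
      m : ℕ
      m = length (E A)

    term-cancels : ∀ A → term κ a b G S A + term κ a b G S (toggle u v A) ≈ 0#
    term-cancels A with edge A u v in edge-uv
    ... | false = ≈-trans (+-congˡ (term-toggle A edge-uv)) (-‿inverseʳ _)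
    ... | true  = begin
      t A + t (toggle u v A)
        ≈⟨ +-comm _ _ ⟩
      t (toggle u v A) + t A
        ≡⟨ cong (λ B → t (toggle u v A) + t B) (toggle-involutive u v A) ⟨
      t (toggle u v A) + t (toggle u v (toggle u v A))
        ≈⟨ +-congˡ (term-toggle (toggle u v A) uv∉toggle) ⟩
      t (toggle u v A) + - t (toggle u v A)
        ≈⟨ -‿inverseʳ _ ⟩
      0# ∎
      where
      t : Adj n → Carrier
      t = term κ a b G S
      uv∉toggle : edge (toggle u v A) u v ≡ false
      uv∉toggle = trans (edge-toggle-pair u v A (inj₁ (refl , refl))) (cong not edge-uv)

    pE≈0 : ∀ {DV} (L : List (Adj n)) → Unique L → (∀ {A} → A ∈ₗ L → InT DV S A) →
           (∀ {A} → InT DV S A → A ∈ₗ L) → pE κ a b G S L ≈ 0#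
    pE≈0 L unique sound complete =
      fold-map≈ε-by-involution (toggle u v) (term κ a b G S) (toggle-involutive u v) (toggle-≢ u v)
        term-cancels unique (complete ∘ InT-toggle u v S u∈S v∈S u≢v ∘ sound)
      where
      u≢v : u ≢ v
      u≢v refl = <-irrefl refl u<v

mainTheorem7 : ∀ {c ℓ} (R : CommutativeRing c ℓ) →
  let open CommutativeRing R
      open RingDefs R
  in (n k DV : ℕ) (p a b κ : Carrier) →
     0 < k → k < n → 1 ≤ DV →
     a * a * p ≈ 1# - p →
     b * b * (1# - p) ≈ p →
     a * b ≈ 1# →
     κ * fromℕ n ≈ fromℕ k →
     (G : Adj n) → IsGraph G →
     (S : Subset n) →
     (L : List (Adj n)) → Unique L →
     (∀ (α : Adj n) → (α ∈ₗ L → InT DV S α) × (InT DV S α → α ∈ₗ L)) →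
     NotIndependent G S →
     pE κ a b G S L ≈ 0#
mainTheorem7 R n k DV p a b κ _ _ _ _ _ a*b≈1 _ G G-graph S L L-unique L≡T S-not-independent
  with u , v , u∈S , v∈S , u<v , uv∈G ← ordered-edge G G-graph S-not-independent =
  pE≈0 R κ a b a*b≈1 G S u<v u∈S v∈S uv∈G L L-unique (proj₁ (L≡T _)) (proj₂ (L≡T _))
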